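{- Given a forest on $n$ vertices and an integer $k \geq 1$, after performing $\lceil \log_{6/5}(1+n/k) \rceil$ rounds of maximal tree contraction, the number of vertices in the resulting forest is at most $k$.
   Context: Maximal tree contraction proceeds in rounds. In each round, on the current forest, a maximal independent set of the vertices of degree one or two (maximal within the subgraph induced by those vertices) is contracted: degree-one vertices are raked (removed) and degree-two vertices are compressed (removed, with their two incident edges replaced by one edge joining their two neighbors); isolated vertices (degree zero) finalize and are removed. -}

module Defs where

open import Data.Nat using (ℕ; zero; suc; _+_; _*_; _^_; _≤_; _<_)
open import Data.Bool using (Bool; true; false; _∧_; _∨_; not; if_then_else_)
open import Data.Fin using (Fin; zero; suc; inject₁; fromℕ; _≟_)
open import Data.List using (List; map; allFin)
open import Data.Nat.ListAction using (sum)
open import Data.Bool.ListAction using (any)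
open import Data.Product using (Σ; _×_)
open import Relation.Nullary using (¬_)
open import Relation.Nullary.Decidable using (⌊_⌋)
open import Relation.Binary.PropositionalEquality using (_≡_)
open import Function.Definitions using (Injective)

-- A (simple) graph whose vertices are drawn from the universe Fin N:
-- `alive v` says whether v is still a vertex, `adj u w` whether uw is an edge.
record Graph (N : ℕ) : Set where
  constructor mkGraph
  field
    alive : Fin N → Bool
    adj   : Fin N → Fin N → Bool
open Graph public

record WellFormed {N : ℕ} (G : Graph N) : Set where
  field
    adj-sym   : ∀ u w → adj G u w ≡ adj G w u
    adj-irr   : ∀ u → adj G u u ≡ false
    adj-alive : ∀ u w → adj G u w ≡ true → alive G u ≡ true
open WellFormed public

Cycle : {N : ℕ} → Graph N → Set
Cycle {N} G =
  Σ ℕ λ m → Σ (Fin (suc (suc (suc m))) → Fin N) λ f →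
    Injective _≡_ _≡_ f
    × (∀ (i : Fin (suc (suc m))) → adj G (f (inject₁ i)) (f (suc i)) ≡ true)
    × (adj G (f (fromℕ (suc (suc m)))) (f zero) ≡ true)

Forest : {N : ℕ} → Graph N → Set
Forest G = WellFormed G × ¬ Cycle G

count : {N : ℕ} → (Fin N → Bool) → ℕ
count {N} p = sum (map (λ u → if p u then 1 else 0) (allFin N))

size : {N : ℕ} → Graph N → ℕ
size G = count (alive G)

degree : {N : ℕ} → Graph N → Fin N → ℕ
degree G v = count (adj G v)

isDeg1or2 : {N : ℕ} → Graph N → Fin N → Bool
isDeg1or2 G v with degree G v
... | 1 = true
... | 2 = true
... | _ = false

isDeg0 : {N : ℕ} → Graph N → Fin N → Bool
isDeg0 G v with degree G v
... | 0 = true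
... | _ = false

isDeg2 : {N : ℕ} → Graph N → Fin N → Bool
isDeg2 G v with degree G v
... | 2 = true
... | _ = false

-- S is a maximal independent set of the subgraph induced by the
-- (alive) vertices of degree one or two.
MaximalContractSet : {N : ℕ} → Graph N → (Fin N → Bool) → Set
MaximalContractSet G S =
    (∀ v → S v ≡ true → alive G v ≡ true × isDeg1or2 G v ≡ true)
  × (∀ u w → S u ≡ true → S w ≡ true → adj G u w ≡ false)
  × (∀ v → alive G v ≡ true → isDeg1or2 G v ≡ true → S v ≡ false →
       Σ (Fin _) λ u → S u ≡ true × adj G u v ≡ true)

-- Result of one round with the chosen set S: vertices of S are removed
-- (degree-one ones raked, degree-two ones compressed, their two neighbours
-- being joined by a new edge); isolated vertices are removed.
contract : {N : ℕ} → Graph N → (Fin N → Bool) → Graph N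
contract {N} G S = mkGraph alive' adj'
  where
  alive' : Fin N → Bool
  alive' v = alive G v ∧ not (S v) ∧ not (isDeg0 G v)
  adj' : Fin N → Fin N → Bool
  adj' u w = alive' u ∧ alive' w ∧
    (adj G u w ∨
     any (λ c → S c ∧ isDeg2 G c ∧ adj G c u ∧ adj G c w ∧ not ⌊ u ≟ w ⌋)
         (allFin N))

-- `Rounds r G G'`: G' arises from G by r rounds of maximal tree contraction
-- (with arbitrary choices of the maximal independent sets).
data Rounds {N : ℕ} : ℕ → Graph N → Graph N → Set where
  done : ∀ {G} → Rounds zero G G
  step : ∀ {r G G'} (S : Fin N → Bool) → MaximalContractSet G S →
         Rounds r (contract G S) G' → Rounds (suc r) G G'

-- r = ⌈ log_{6/5} (1 + n/k) ⌉, i.e. r is the least natural number with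
-- (6/5)^r ≥ 1 + n/k, i.e. 6^r * k ≥ 5^r * (k + n).
IsCeilLog : ℕ → ℕ → ℕ → Set
IsCeilLog n k r =
  (5 ^ r * (k + n) ≤ 6 ^ r * k)
  × (∀ r' → r' < r → 6 ^ r' * k < 5 ^ r' * (k + n))

-- Call a map `parent` on the vertices a parent map if every edge uw has parent u = w or
-- parent w = u. Every forest has one (remove a leaf, recurse, let the leaf point to its
-- neighbour), and a round of contraction preserves it: a compressed vertex c is bypassed,
-- the endpoint that pointed to c now pointing to the other neighbour of c. In a graph with
-- a parent map, charging each edge uw to the endpoint whose parent is the other one charges
-- every vertex at most once, so the degree sum is at most twice the number d of non-isolated vertices. Hence the vertices of
-- degree at least three are no more numerous than those of degree one or two, which are
-- therefore at least d/2. By maximality each of these is in the chosen set S or adjacent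
-- to a vertex of S, and a vertex of S has at most two neighbours, so d ≤ 6|S|. The
-- survivors are the d - |S| ≤ 5d/6 non-isolated vertices outside S, so each round shrinks
-- the forest by a factor 5/6, and after r rounds its size is at most (5/6)^r n ≤ k.
module Submission where

open import Defs
open import Data.Bool using (Bool; true; false; _∧_; _∨_; not; if_then_else_)
open import Data.Bool.ListAction using (any; or)
open import Data.Bool.Properties
  using (¬-not; ∧-zeroʳ; ∨-zeroʳ; ∧-assoc; ∧-comm; not-involutive) renaming (_≟_ to _≟ᵇ_)
open import Data.Fin using (Fin; zero; suc; _≟_; toℕ; fromℕ; fromℕ<; inject₁)
open import Data.Fin.Properties
  using (any?; pigeonhole; <-cmp; toℕ<n; toℕ-fromℕ<; toℕ-fromℕ; toℕ-inject₁)
open import Data.List using (_∷_; tabulate; allFin)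
open import Data.List.Properties using (map-tabulate; map-cong)
open import Data.Nat using (ℕ; zero; suc; _+_; _*_; _^_; _≤_; _<_; _≤ᵇ_; z≤n; s≤s; s≤s⁻¹)
import Data.Nat.ListAction as List
open import Data.Nat.Induction using (<-wellFounded)
open import Data.Nat.Properties
  using ( ≤-refl; ≤-trans; ≤-reflexive; <-irrefl; <⇒≤; n<1+n; n>0⇒n≢0; 1+n≢n; suc-injective
        ; +-comm; +-suc; +-identityʳ; *-assoc; *-distribˡ-+; m≤n+m; m≤n⇒∃[o]m+o≡n
        ; +-mono-≤; +-mono-<-≤; +-mono-≤-<; +-monoʳ-≤; +-monoʳ-<; *-monoʳ-≤
        ; +-cancelˡ-≤; +-cancelʳ-≤; *-cancelˡ-≤; m^n≢0; +-*-semiring; module ≤-Reasoning)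
  renaming (_≟_ to _≟ℕ_)
open import Algebra.Properties.Semiring.Sum +-*-semiring
  using (sum; sum-cong-≗; sum-replicate-zero; ∑-distrib-+; ∑-comm; *-distribˡ-sum)
open import Data.Nat.Tactic.RingSolver using (solve-∀)
open import Data.Product using (∃-syntax; _×_; _,_; proj₁; proj₂)
open import Data.Sum using (_⊎_; inj₁; inj₂)
open import Function using (_∘_; id)
open import Induction.WellFounded using (Acc; acc)
open import Relation.Binary.Definitions using (tri<; tri≈; tri>)
open import Relation.Binary.PropositionalEquality
open import Relation.Nullary using (¬_; Dec; yes; no; does; contradiction)
open import Relation.Nullary.Decidable using (⌊_⌋; dec-true; dec-false)

∧-true : ∀ a {b} → a ∧ b ≡ true → a ≡ true × b ≡ true
∧-true true e = refl , e

∨-true : ∀ a {b} → a ∨ b ≡ true → a ≡ true ⊎ b ≡ true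
∨-true true  _ = inj₁ refl
∨-true false e = inj₂ e

∧-swap : ∀ a b c → a ∧ (b ∧ c) ≡ b ∧ (a ∧ c)
∧-swap a b c = trans (sym (∧-assoc a b c)) (trans (cong (_∧ c) (∧-comm a b)) (∧-assoc b a c))

any-witness : ∀ {A : Set} (p : A → Bool) xs → any p xs ≡ true → ∃[ x ] p x ≡ true
any-witness p (x ∷ xs) e with p x in px
... | true  = x , px
... | false = any-witness p xs e

⌊≟⌋-sym : ∀ {N} (u w : Fin N) → ⌊ u ≟ w ⌋ ≡ ⌊ w ≟ u ⌋
⌊≟⌋-sym u w with u ≟ w | w ≟ u
... | yes _   | yes _   = refl
... | no _    | no _    = refl
... | yes u≡w | no w≢u  = contradiction (sym u≡w) w≢u
... | no u≢w  | yes w≡u = contradiction (sym w≡u) u≢w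

not⌊≟⌋⇒≢ : ∀ {N} {u w : Fin N} → not ⌊ u ≟ w ⌋ ≡ true → u ≢ w
not⌊≟⌋⇒≢ {u = u} {w} e with u ≟ w
... | no u≢w = u≢w

-- Counting

χ : Bool → ℕ
χ b = if b then 1 else 0

sum-mono-≤ : ∀ {N} {f g : Fin N → ℕ} → (∀ x → f x ≤ g x) → sum f ≤ sum g
sum-mono-≤ {zero}  f≤g = z≤n
sum-mono-≤ {suc N} f≤g = +-mono-≤ (f≤g zero) (sum-mono-≤ (f≤g ∘ suc))

sum-mono-< : ∀ {N} {f g : Fin N → ℕ} → (∀ x → f x ≤ g x) → ∀ x → f x < g x → sum f < sum g
sum-mono-< f≤g zero    fx<gx = +-mono-<-≤ fx<gx (sum-mono-≤ (f≤g ∘ suc))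
sum-mono-< f≤g (suc x) fx<gx = +-mono-≤-< (f≤g zero) (sum-mono-< (f≤g ∘ suc) x fx<gx)

count≡sum : ∀ {N} (p : Fin N → Bool) → count p ≡ sum (χ ∘ p)
count≡sum p = trans (cong List.sum (map-tabulate id (χ ∘ p))) (sum-tabulate (χ ∘ p))
  where
  sum-tabulate : ∀ {n} (f : Fin n → ℕ) → List.sum (tabulate f) ≡ sum f
  sum-tabulate {zero}  f = refl
  sum-tabulate {suc n} f = cong (f zero +_) (sum-tabulate (f ∘ suc))

-- Written with `does` rather than ⌊_⌋ so that ((p ∖ suc u) ∘ suc) x reduces to ((p ∘ suc) ∖ u) x.
_∖_ : ∀ {N} → (Fin N → Bool) → Fin N → Fin N → Bool
(p ∖ u) x = not (does (x ≟ u)) ∧ p x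

∖-intro : ∀ {N} {p : Fin N → Bool} {u x} → x ≢ u → p x ≡ true → (p ∖ u) x ≡ true
∖-intro {u = u} {x} x≢u px rewrite dec-false (x ≟ u) x≢u = px

∖-elim : ∀ {N} {p : Fin N → Bool} {u x} → (p ∖ u) x ≡ true → x ≢ u × p x ≡ true
∖-elim {u = u} {x} px with x ≟ u
... | no x≢u = x≢u , px

count-∖ : ∀ {N} (p : Fin N → Bool) {u} → p u ≡ true → count p ≡ suc (count (p ∖ u))
count-∖ p {u} pu rewrite count≡sum p | count≡sum (p ∖ u) = sum-χ-∖ p u pu
  where
  sum-χ-∖ : ∀ {N} (p : Fin N → Bool) u → p u ≡ true →
            sum (χ ∘ p) ≡ suc (sum (χ ∘ (p ∖ u)))
  sum-χ-∖ p zero    pu rewrite pu = refl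
  sum-χ-∖ p (suc u) pu = trans (cong (χ (p zero) +_) (sum-χ-∖ (p ∘ suc) u pu))
                               (+-suc (χ (p zero)) (sum (χ ∘ ((p ∘ suc) ∖ u))))

true⇒count>0 : ∀ {N} (p : Fin N → Bool) {x} → p x ≡ true → 0 < count p
true⇒count>0 p px rewrite count-∖ p px = s≤s z≤n

count≡0⇒false : ∀ {N} (p : Fin N → Bool) → count p ≡ 0 → ∀ x → p x ≡ false
count≡0⇒false p count≡0 x with p x in px
... | false = refl
... | true  = contradiction count≡0 (n>0⇒n≢0 (true⇒count>0 p px))

allFalse⇒count≡0 : ∀ {N} (p : Fin N → Bool) → (∀ x → p x ≡ false) → count p ≡ 0
allFalse⇒count≡0 {N} p allFalse = begin
  count p           ≡⟨ count≡sum p ⟩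
  sum (χ ∘ p)       ≡⟨ sum-cong-≗ (cong χ ∘ allFalse) ⟩
  sum {N} (λ _ → 0) ≡⟨ sum-replicate-zero N ⟩
  0                 ∎
  where open ≡-Reasoning

¬∃⇒count≡0 : ∀ {N} (p : Fin N → Bool) → ¬ (∃[ x ] p x ≡ true) → count p ≡ 0
¬∃⇒count≡0 p none = allFalse⇒count≡0 p (λ x → ¬-not (λ px → none (x , px)))

count>0⇒∃ : ∀ {N} (p : Fin N → Bool) → 0 < count p → ∃[ x ] p x ≡ true
count>0⇒∃ p count>0 with any? (λ x → p x ≟ᵇ true)
... | yes witness = witness
... | no none     = contradiction (¬∃⇒count≡0 p none) (n>0⇒n≢0 count>0)

count≤1⇒unique : ∀ {N} (p : Fin N → Bool) → count p ≤ 1 →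
                 ∀ {u w} → p u ≡ true → p w ≡ true → u ≡ w
count≤1⇒unique p count≤1 {u} {w} pu pw with u ≟ w
... | yes u≡w = u≡w
... | no u≢w  = contradiction (≤-trans two≤count count≤1) (<-irrefl refl ∘ s≤s⁻¹)
  where
  two≤count : 2 ≤ count p
  two≤count = subst (2 ≤_) (sym (count-∖ p pu))
                    (s≤s (true⇒count>0 (p ∖ u) (∖-intro {p = p} (u≢w ∘ sym) pw)))

unique⇒count≤1 : ∀ {N} (p : Fin N → Bool) →
                 (∀ {u w} → p u ≡ true → p w ≡ true → u ≡ w) → count p ≤ 1
unique⇒count≤1 p unique with any? (λ x → p x ≟ᵇ true)
... | no none      = ≤-trans (≤-reflexive (¬∃⇒count≡0 p none)) z≤n
... | yes (u , pu) = ≤-reflexive (trans (count-∖ p pu) (cong suc (allFalse⇒count≡0 (p ∖ u) onlyU)))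
  where
  onlyU : ∀ x → (p ∖ u) x ≡ false
  onlyU x with (p ∖ u) x in p∖ux
  ... | false = refl
  ... | true  = let x≢u , px = ∖-elim {p = p} p∖ux in contradiction (unique px pu) x≢u

count-mono : ∀ {N} (p q : Fin N → Bool) → (∀ x → p x ≡ true → q x ≡ true) →
             count p ≤ count q
count-mono p q p⊆q rewrite count≡sum p | count≡sum q = sum-mono-≤ χ-mono
  where
  χ-mono : ∀ x → χ (p x) ≤ χ (q x)
  χ-mono x with p x in px
  ... | false = z≤n
  ... | true rewrite p⊆q x px = ≤-refl

count-split : ∀ {N} (r p q : Fin N → Bool) → (∀ x → χ (r x) ≡ χ (p x) + χ (q x)) →
              count r ≡ count p + count q
count-split r p q split = begin
  count r                       ≡⟨ count≡sum r ⟩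
  sum (χ ∘ r)                   ≡⟨ sum-cong-≗ split ⟩
  sum (λ x → χ (p x) + χ (q x)) ≡⟨ ∑-distrib-+ (χ ∘ p) (χ ∘ q) ⟩
  sum (χ ∘ p) + sum (χ ∘ q)     ≡⟨ cong₂ _+_ (count≡sum p) (count≡sum q) ⟨
  count p + count q             ∎
  where open ≡-Reasoning

count-∨ : ∀ {N} (p q : Fin N → Bool) → count (λ x → p x ∨ q x) ≤ count p + count q
count-∨ p q = begin
  count (λ x → p x ∨ q x)       ≡⟨ count≡sum (λ x → p x ∨ q x) ⟩
  sum (λ x → χ (p x ∨ q x))     ≤⟨ sum-mono-≤ (λ x → χ-∨ (p x) (q x)) ⟩
  sum (λ x → χ (p x) + χ (q x)) ≡⟨ ∑-distrib-+ (χ ∘ p) (χ ∘ q) ⟩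
  sum (χ ∘ p) + sum (χ ∘ q)     ≡⟨ cong₂ _+_ (count≡sum p) (count≡sum q) ⟨
  count p + count q             ∎
  where
  open ≤-Reasoning
  χ-∨ : ∀ a b → χ (a ∨ b) ≤ χ a + χ b
  χ-∨ true  b = s≤s z≤n
  χ-∨ false b = ≤-refl

sum-count-swap : ∀ {N} (R : Fin N → Fin N → Bool) →
                 sum (λ x → count (λ u → R u x)) ≡ sum (λ u → count (R u))
sum-count-swap R = begin
  sum (λ x → count (λ u → R u x))   ≡⟨ sum-cong-≗ (λ x → count≡sum (λ u → R u x)) ⟩
  sum (λ x → sum (λ u → χ (R u x))) ≡⟨ ∑-comm (λ x u → χ (R u x)) ⟩
  sum (λ u → sum (λ x → χ (R u x))) ≡⟨ sum-cong-≗ (λ u → count≡sum (R u)) ⟨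
  sum (λ u → count (R u))           ∎
  where open ≡-Reasoning

-- Degrees

nonIsolated : ∀ {N} → Graph N → Fin N → Bool
nonIsolated G v = not (isDeg0 G v)

isDeg≥3 : ∀ {N} → Graph N → Fin N → Bool
isDeg≥3 G v = 3 ≤ᵇ degree G v

module _ {N : ℕ} (G : Graph N) where

  isolated⇒¬adj : ∀ {v} → isDeg0 G v ≡ true → ∀ w → adj G v w ≡ false
  isolated⇒¬adj {v} isolated = count≡0⇒false (adj G v) (degree≡0 isolated)
    where
    degree≡0 : isDeg0 G v ≡ true → degree G v ≡ 0
    degree≡0 _ with degree G v
    ... | zero = refl

  nonIsolated⇒degree>0 : ∀ {v} → nonIsolated G v ≡ true → 0 < degree G v
  nonIsolated⇒degree>0 {v} _ with degree G v
  ... | suc _ = s≤s z≤n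

  isDeg1or2⇒nonIsolated : ∀ {v} → isDeg1or2 G v ≡ true → nonIsolated G v ≡ true
  isDeg1or2⇒nonIsolated {v} _ with degree G v
  ... | suc _ = refl

  isDeg1or2⇒degree≤2 : ∀ {v} → isDeg1or2 G v ≡ true → degree G v ≤ 2
  isDeg1or2⇒degree≤2 {v} _ with degree G v
  ... | 1 = s≤s z≤n
  ... | 2 = s≤s (s≤s z≤n)

  isDeg2⇒degree≡2 : ∀ {v} → isDeg2 G v ≡ true → degree G v ≡ 2
  isDeg2⇒degree≡2 {v} _ with degree G v
  ... | 2 = refl

  nonIsolated⇒alive : WellFormed G → ∀ {v} → nonIsolated G v ≡ true → alive G v ≡ true
  nonIsolated⇒alive wf {v} nonIso =
    let w , vw = count>0⇒∃ (adj G v) (nonIsolated⇒degree>0 nonIso) in adj-alive wf v w vw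

  count-nonIsolated : count (nonIsolated G) ≡ count (isDeg1or2 G) + count (isDeg≥3 G)
  count-nonIsolated = count-split (nonIsolated G) (isDeg1or2 G) (isDeg≥3 G) split
    where
    split : ∀ v → χ (nonIsolated G v) ≡ χ (isDeg1or2 G v) + χ (isDeg≥3 G v)
    split v with degree G v
    ... | 0 = refl
    ... | 1 = refl
    ... | 2 = refl
    ... | suc (suc (suc _)) = refl

  degreeSum-lowerBound : count (isDeg1or2 G) + 3 * count (isDeg≥3 G) ≤ sum (degree G)
  degreeSum-lowerBound = begin
    count (isDeg1or2 G) + 3 * count (isDeg≥3 G)
      ≡⟨ cong₂ _+_ (count≡sum (isDeg1or2 G)) (cong (3 *_) (count≡sum (isDeg≥3 G))) ⟩
    sum (χ ∘ isDeg1or2 G) + 3 * sum (χ ∘ isDeg≥3 G)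
      ≡⟨ cong (sum (χ ∘ isDeg1or2 G) +_) (*-distribˡ-sum 3 (χ ∘ isDeg≥3 G)) ⟩
    sum (χ ∘ isDeg1or2 G) + sum (λ v → 3 * χ (isDeg≥3 G v))
      ≡⟨ ∑-distrib-+ (χ ∘ isDeg1or2 G) (λ v → 3 * χ (isDeg≥3 G v)) ⟨
    sum (λ v → χ (isDeg1or2 G v) + 3 * χ (isDeg≥3 G v))
      ≤⟨ sum-mono-≤ bound ⟩
    sum (degree G) ∎
    where
    open ≤-Reasoning
    bound : ∀ v → χ (isDeg1or2 G v) + 3 * χ (isDeg≥3 G v) ≤ degree G v
    bound v with degree G v
    ... | 0 = z≤n
    ... | 1 = s≤s z≤n
    ... | 2 = s≤s z≤n
    ... | suc (suc (suc _)) = s≤s (s≤s (s≤s z≤n))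

  otherNeighbour : Fin N → Fin N → Fin N
  otherNeighbour c x with any? (λ y → (adj G c ∖ x) y ≟ᵇ true)
  ... | yes (y , _) = y
  ... | no _        = x

  otherNeighbour-adj : ∀ {c x} → adj G c x ≡ true → degree G c ≢ 1 →
                       (adj G c ∖ x) (otherNeighbour c x) ≡ true
  otherNeighbour-adj {c} {x} cx degree≢1 with any? (λ y → (adj G c ∖ x) y ≟ᵇ true)
  ... | yes (_ , cy) = cy
  ... | no none      =
    contradiction (trans (count-∖ (adj G c) cx) (cong suc (¬∃⇒count≡0 _ none))) degree≢1

  otherNeighbour-unique : ∀ {c u w} → degree G c ≡ 2 → adj G c u ≡ true → adj G c w ≡ true →
                          u ≢ w → otherNeighbour c w ≡ u
  otherNeighbour-unique {c} {u} {w} degree≡2 cu cw u≢w =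
    count≤1⇒unique (adj G c ∖ w) count≤1
      (otherNeighbour-adj cw (λ degree≡1 → 1+n≢n (trans (sym degree≡2) degree≡1)))
      (∖-intro {p = adj G c} u≢w cu)
    where
    count≤1 : count (adj G c ∖ w) ≤ 1
    count≤1 = ≤-reflexive (suc-injective (trans (sym (count-∖ (adj G c) cw)) degree≡2))

-- Parent maps

-- Graphs with a parent map are those whose components contain at most one cycle. This is
-- all the counting needs, and unlike acyclicity it visibly survives contraction.
record ParentMap {N : ℕ} (G : Graph N) : Set where
  field
    parent      : Fin N → Fin N
    edge-parent : ∀ u w → adj G u w ≡ true → parent u ≡ w ⊎ parent w ≡ u
open ParentMap

module _ {N : ℕ} {G : Graph N} (wf : WellFormed G) (P : ParentMap G) where

  private
    parentEdge : Fin N → Fin N → Bool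
    parentEdge x u = adj G x u ∧ does (parent P x ≟ u)

    parentEdge-intro : ∀ {x u} → adj G x u ≡ true → parent P x ≡ u → parentEdge x u ≡ true
    parentEdge-intro {x} {u} xu px≡u rewrite xu = dec-true (parent P x ≟ u) px≡u

    parentEdge-elim : ∀ {x u} → parentEdge x u ≡ true → parent P x ≡ u
    parentEdge-elim {x} {u} e with parent P x ≟ u
    ... | yes px≡u = px≡u
    ... | no _     = contradiction (trans (sym e) (∧-zeroʳ (adj G x u))) λ ()

    degree≤parentEdges : ∀ x → degree G x ≤ count (parentEdge x) + count (λ u → parentEdge u x)
    degree≤parentEdges x =
      ≤-trans (count-mono (adj G x) _ covered) (count-∨ (parentEdge x) (λ u → parentEdge u x))
      where
      covered : ∀ u → adj G x u ≡ true → (parentEdge x u ∨ parentEdge u x) ≡ true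
      covered u xu with edge-parent P x u xu
      ... | inj₁ px≡u = cong (_∨ parentEdge u x) (parentEdge-intro xu px≡u)
      ... | inj₂ pu≡x =
        trans (cong (parentEdge x u ∨_) (parentEdge-intro (trans (adj-sym wf u x) xu) pu≡x)) (∨-zeroʳ _)

    count-parentEdge : ∀ x → count (parentEdge x) ≤ χ (nonIsolated G x)
    count-parentEdge x with isDeg0 G x in iso
    ... | true  =
      ≤-reflexive (allFalse⇒count≡0 (parentEdge x) λ u → cong (_∧ _) (isolated⇒¬adj G iso u))
    ... | false =
      unique⇒count≤1 (parentEdge x) λ xu xw → trans (sym (parentEdge-elim xu)) (parentEdge-elim xw)

    sum-count-parentEdge : sum (λ x → count (parentEdge x)) ≤ count (nonIsolated G)
    sum-count-parentEdge =
      ≤-trans (sum-mono-≤ count-parentEdge) (≤-reflexive (sym (count≡sum (nonIsolated G))))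

  degreeSum≤2*count-nonIsolated : sum (degree G) ≤ 2 * count (nonIsolated G)
  degreeSum≤2*count-nonIsolated = begin
    sum (degree G)
      ≤⟨ sum-mono-≤ degree≤parentEdges ⟩
    sum (λ x → count (parentEdge x) + count (λ u → parentEdge u x))
      ≡⟨ ∑-distrib-+ (λ x → count (parentEdge x)) (λ x → count (λ u → parentEdge u x)) ⟩
    sum (λ x → count (parentEdge x)) + sum (λ x → count (λ u → parentEdge u x))
      ≡⟨ cong (sum (λ x → count (parentEdge x)) +_) (sum-count-swap parentEdge) ⟩
    sum (λ x → count (parentEdge x)) + sum (λ x → count (parentEdge x))
      ≤⟨ +-mono-≤ sum-count-parentEdge sum-count-parentEdge ⟩
    count (nonIsolated G) + count (nonIsolated G)
      ≡⟨ cong (count (nonIsolated G) +_) (+-identityʳ (count (nonIsolated G))) ⟨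
    2 * count (nonIsolated G) ∎
    where open ≤-Reasoning

-- One round

module _ {N : ℕ} {G : Graph N} (wf : WellFormed G) where

  count-nonIsolated≤2*count-isDeg1or2 : ParentMap G → count (nonIsolated G) ≤ 2 * count (isDeg1or2 G)
  count-nonIsolated≤2*count-isDeg1or2 P = begin
    count (nonIsolated G) ≡⟨ count-nonIsolated G ⟩
    b + a                 ≤⟨ +-monoʳ-≤ b a≤b ⟩
    b + b                 ≡⟨ cong (b +_) (+-identityʳ b) ⟨
    2 * b                 ∎
    where
    open ≤-Reasoning
    a b : ℕ
    a = count (isDeg≥3 G)
    b = count (isDeg1or2 G)
    b+3a≤2[b+a] : b + 3 * a ≤ 2 * (b + a)
    b+3a≤2[b+a] = begin
      b + 3 * a                 ≤⟨ degreeSum-lowerBound G ⟩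
      sum (degree G)            ≤⟨ degreeSum≤2*count-nonIsolated wf P ⟩
      2 * count (nonIsolated G) ≡⟨ cong (2 *_) (count-nonIsolated G) ⟩
      2 * (b + a)               ∎
    a≤b : a ≤ b
    a≤b = +-cancelˡ-≤ (b + 2 * a) a b (begin
      (b + 2 * a) + a ≡⟨ lhs b a ⟩
      b + 3 * a       ≤⟨ b+3a≤2[b+a] ⟩
      2 * (b + a)     ≡⟨ rhs b a ⟩
      (b + 2 * a) + b ∎)
      where
      lhs : ∀ b a → (b + 2 * a) + a ≡ b + 3 * a
      lhs = solve-∀
      rhs : ∀ b a → 2 * (b + a) ≡ (b + 2 * a) + b
      rhs = solve-∀

  module _ {S : Fin N → Bool} (mcs : MaximalContractSet G S) where

    private
      S⇒isDeg1or2 : ∀ {v} → S v ≡ true → isDeg1or2 G v ≡ true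
      S⇒isDeg1or2 sv = proj₂ (proj₁ mcs _ sv)

      S-maximal : ∀ v → alive G v ≡ true → isDeg1or2 G v ≡ true → S v ≡ false →
                  ∃[ c ] S c ≡ true × adj G c v ≡ true
      S-maximal = proj₂ (proj₂ mcs)

    count-isDeg1or2≤3*count : count (isDeg1or2 G) ≤ 3 * count S
    count-isDeg1or2≤3*count = begin
      count (isDeg1or2 G)
        ≡⟨ count≡sum (isDeg1or2 G) ⟩
      sum (χ ∘ isDeg1or2 G)
        ≤⟨ sum-mono-≤ dominated ⟩
      sum (λ v → χ (S v) + count (λ c → S c ∧ adj G c v))
        ≡⟨ ∑-distrib-+ (χ ∘ S) (λ v → count (λ c → S c ∧ adj G c v)) ⟩
      sum (χ ∘ S) + sum (λ v → count (λ c → S c ∧ adj G c v))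
        ≡⟨ cong₂ _+_ (count≡sum S) (sym (sum-count-swap (λ c v → S c ∧ adj G c v))) ⟨
      count S + sum (λ c → count (λ v → S c ∧ adj G c v))
        ≤⟨ +-monoʳ-≤ (count S) (sum-mono-≤ neighbours≤2) ⟩
      count S + sum (λ c → 2 * χ (S c))
        ≡⟨ cong (count S +_) (*-distribˡ-sum 2 (χ ∘ S)) ⟨
      count S + 2 * sum (χ ∘ S)
        ≡⟨ cong (λ c → count S + 2 * c) (count≡sum S) ⟨
      count S + 2 * count S
        ≡⟨⟩
      3 * count S ∎
      where
      open ≤-Reasoning
      dominated : ∀ v → χ (isDeg1or2 G v) ≤ χ (S v) + count (λ c → S c ∧ adj G c v)
      dominated v with S v in sv | isDeg1or2 G v in d12
      ... | _     | false = z≤n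
      ... | true  | true  = s≤s z≤n
      ... | false | true  =
        let c , sc , cv = S-maximal v (nonIsolated⇒alive G wf (isDeg1or2⇒nonIsolated G d12)) d12 sv
        in true⇒count>0 (λ c → S c ∧ adj G c v) (cong₂ _∧_ sc cv)
      neighbours≤2 : ∀ c → count (λ v → S c ∧ adj G c v) ≤ 2 * χ (S c)
      neighbours≤2 c with S c in sc
      ... | true  = isDeg1or2⇒degree≤2 G (S⇒isDeg1or2 sc)
      ... | false = ≤-reflexive (allFalse⇒count≡0 (λ v → false ∧ adj G c v) (λ _ → refl))

    count-alive-contract : count (alive (contract G S)) + count S ≡ count (nonIsolated G)
    count-alive-contract = sym (count-split (nonIsolated G) (alive (contract G S)) S split)
      where
      split : ∀ v → χ (nonIsolated G v) ≡ χ (alive (contract G S) v) + χ (S v)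
      split v with S v in sv
      ... | true
        rewrite isDeg1or2⇒nonIsolated G (S⇒isDeg1or2 sv) | ∧-zeroʳ (alive G v) = refl
      ... | false with isDeg0 G v in iso
      ...   | true  rewrite ∧-zeroʳ (alive G v) = refl
      ...   | false rewrite nonIsolated⇒alive G wf (cong not iso) = refl

    6*size-contract≤5*size : ParentMap G → 6 * size (contract G S) ≤ 5 * size G
    6*size-contract≤5*size P = begin
      6 * size (contract G S)
        ≤⟨ shrink {size (contract G S)} {count S} count-alive-contract count-nonIsolated≤6*count ⟩
      5 * count (nonIsolated G)
        ≤⟨ *-monoʳ-≤ 5 (count-mono (nonIsolated G) (alive G) (λ _ → nonIsolated⇒alive G wf)) ⟩
      5 * size G ∎
      where
      open ≤-Reasoning
      count-nonIsolated≤6*count : count (nonIsolated G) ≤ 6 * count S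
      count-nonIsolated≤6*count = begin
        count (nonIsolated G)   ≤⟨ count-nonIsolated≤2*count-isDeg1or2 P ⟩
        2 * count (isDeg1or2 G) ≤⟨ *-monoʳ-≤ 2 count-isDeg1or2≤3*count ⟩
        2 * (3 * count S)       ≡⟨ *-assoc 2 3 (count S) ⟨
        6 * count S             ∎
      shrink : ∀ {s c n} → s + c ≡ n → n ≤ 6 * c → 6 * s ≤ 5 * n
      shrink {s} {c} {n} s+c≡n n≤6c = +-cancelʳ-≤ n (6 * s) (5 * n) (begin
        6 * s + n     ≤⟨ +-monoʳ-≤ (6 * s) n≤6c ⟩
        6 * s + 6 * c ≡⟨ *-distribˡ-+ 6 s c ⟨
        6 * (s + c)   ≡⟨ cong (6 *_) s+c≡n ⟩
        6 * n         ≡⟨ +-comm n (5 * n) ⟩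
        5 * n + n     ∎)

-- Contraction preserves parent maps

module _ {N : ℕ} {G : Graph N} (wf : WellFormed G) {S : Fin N → Bool} where

  private
    G′ : Graph N
    G′ = contract G S

    compressedVia : Fin N → Fin N → Fin N → Bool
    compressedVia u w c = S c ∧ isDeg2 G c ∧ adj G c u ∧ adj G c w ∧ not ⌊ u ≟ w ⌋

    compressedVia-sym : ∀ u w c → compressedVia u w c ≡ compressedVia w u c
    compressedVia-sym u w c =
      cong (λ z → S c ∧ isDeg2 G c ∧ z)
           (trans (∧-swap (adj G c u) (adj G c w) _)
                  (cong (λ z → adj G c w ∧ adj G c u ∧ not z) (⌊≟⌋-sym u w)))

  contract-alive⇒¬S : ∀ {v} → alive G′ v ≡ true → S v ≡ false
  contract-alive⇒¬S {v} e =
    trans (sym (not-involutive (S v)))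
          (cong not (proj₁ (∧-true (not (S v)) (proj₂ (∧-true (alive G v) e)))))

  contract-adj-elim : ∀ {u w} → adj G′ u w ≡ true →
    alive G′ u ≡ true × alive G′ w ≡ true ×
    (adj G u w ≡ true ⊎
     ∃[ c ] S c ≡ true × isDeg2 G c ≡ true × adj G c u ≡ true × adj G c w ≡ true × u ≢ w)
  contract-adj-elim {u} {w} e with ∧-true (alive G′ u) e
  ... | u′ , e′ with ∧-true (alive G′ w) e′
  ... | w′ , edge with ∨-true (adj G u w) edge
  ... | inj₁ uw = u′ , w′ , inj₁ uw
  ... | inj₂ via with any-witness (compressedVia u w) (allFin N) via
  ... | c , k with ∧-true (S c) k
  ... | sc , k₁ with ∧-true (isDeg2 G c) k₁
  ... | d₂ , k₂ with ∧-true (adj G c u) k₂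
  ... | cu , k₃ with ∧-true (adj G c w) k₃
  ... | cw , u≢w = u′ , w′ , inj₂ (c , sc , d₂ , cu , cw , not⌊≟⌋⇒≢ u≢w)

  contract-wellFormed : WellFormed G′
  adj-sym contract-wellFormed u w =
    trans (cong (λ z → alive G′ u ∧ alive G′ w ∧ z)
                (cong₂ _∨_ (adj-sym wf u w) (cong or (map-cong (compressedVia-sym u w) (allFin N)))))
          (∧-swap (alive G′ u) (alive G′ w) _)
  adj-irr contract-wellFormed u = ¬-not no-loop
    where
    no-loop : adj G′ u u ≢ true
    no-loop e with contract-adj-elim e
    ... | _ , _ , inj₁ uu = contradiction (trans (sym uu) (adj-irr wf u)) λ ()
    ... | _ , _ , inj₂ (_ , _ , _ , _ , _ , u≢u) = u≢u refl
  adj-alive contract-wellFormed u w e = proj₁ (contract-adj-elim e)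

  contract-parentMap : ParentMap G → ParentMap G′
  contract-parentMap P = record { parent = parent′ ; edge-parent = edge-parent′ }
    where
    parent′ : Fin N → Fin N
    parent′ x = let c = parent P x in if S c ∧ isDeg2 G c then otherNeighbour G c x else c

    parent′-kept : ∀ {x y} → parent P x ≡ y → alive G′ y ≡ true → parent′ x ≡ y
    parent′-kept refl y′ rewrite contract-alive⇒¬S y′ = refl

    parent′-bypass : ∀ {x y c} → parent P x ≡ c → S c ≡ true → isDeg2 G c ≡ true →
                     adj G c y ≡ true → adj G c x ≡ true → y ≢ x → parent′ x ≡ y
    parent′-bypass refl sc d₂ cy cx y≢x rewrite sc | d₂ =
      otherNeighbour-unique G (isDeg2⇒degree≡2 G d₂) cy cx y≢x

    edge-parent′ : ∀ u w → adj G′ u w ≡ true → parent′ u ≡ w ⊎ parent′ w ≡ u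
    edge-parent′ u w e with contract-adj-elim e
    ... | u′ , w′ , inj₁ uw with edge-parent P u w uw
    ...   | inj₁ pu≡w = inj₁ (parent′-kept pu≡w w′)
    ...   | inj₂ pw≡u = inj₂ (parent′-kept pw≡u u′)
    edge-parent′ u w e | _ , _ , inj₂ (c , sc , d₂ , cu , cw , u≢w)
      with edge-parent P c u cu | edge-parent P c w cw
    ... | inj₁ pc≡u | inj₁ pc≡w = contradiction (trans (sym pc≡u) pc≡w) u≢w
    ... | _         | inj₂ pw≡c = inj₂ (parent′-bypass pw≡c sc d₂ cu cw u≢w)
    ... | inj₂ pu≡c | _         = inj₁ (parent′-bypass pu≡c sc d₂ cw cu (u≢w ∘ sym))

-- Forests have parent maps

minimal : {P : ℕ → Set} → (∀ n → Dec (P n)) →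
          ∀ {n} → P n → ∃[ m ] P m × (∀ {k} → k < m → ¬ P k)
minimal {P} P? = go (<-wellFounded _)
  where
  go : ∀ {n} → Acc _<_ n → P n → ∃[ m ] P m × (∀ {k} → k < m → ¬ P k)
  go {n} (acc smaller) pn with any? (λ (k : Fin n) → P? (toℕ k))
  ... | yes (k , pk) = go (smaller (toℕ<n k)) pk
  ... | no none      = n , pn , λ k<n pk → none (fromℕ< k<n , subst P (sym (toℕ-fromℕ< k<n)) pk)

module _ {N : ℕ} {G : Graph N} (wf : WellFormed G) (w : ℕ → Fin N)
         (walk-adj : ∀ i → adj G (w i) (w (suc i)) ≡ true)
         (no-backtrack : ∀ i → w (suc (suc i)) ≢ w i) where

  private
    closedWalk⇒cycle : ∀ i k → i < i + k → w (i + k) ≡ w i →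
                       (∀ {x y} → x < y → y < i + k → w x ≢ w y) → Cycle G
    closedWalk⇒cycle i zero i<i _ _ = contradiction (subst (i <_) (+-identityʳ i) i<i) (<-irrefl refl)
    closedWalk⇒cycle i 1 _ closed _ = contradiction (trans (sym loop) (adj-irr wf (w i))) λ ()
      where
      loop : adj G (w i) (w i) ≡ true
      loop = subst (λ z → adj G (w i) z ≡ true) (trans (cong w (+-comm 1 i)) closed) (walk-adj i)
    closedWalk⇒cycle i 2 _ closed _ = contradiction (trans (cong w (+-comm 2 i)) closed) (no-backtrack i)
    closedWalk⇒cycle i (suc (suc (suc m))) _ closed distinct = m , f , f-injective , f-adj , f-close
      where
      f : Fin (suc (suc (suc m))) → Fin N
      f t = w (i + toℕ t)
      inSegment : ∀ t → i + toℕ t < i + suc (suc (suc m))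
      inSegment t = +-monoʳ-< i (toℕ<n t)
      f-injective : ∀ {s t} → f s ≡ f t → s ≡ t
      f-injective {s} {t} fs≡ft with <-cmp s t
      ... | tri< s<t _ _ = contradiction fs≡ft (distinct (+-monoʳ-< i s<t) (inSegment t))
      ... | tri≈ _ s≡t _ = s≡t
      ... | tri> _ _ t<s = contradiction (sym fs≡ft) (distinct (+-monoʳ-< i t<s) (inSegment s))
      f-adj : ∀ t → adj G (f (inject₁ t)) (f (suc t)) ≡ true
      f-adj t rewrite toℕ-inject₁ t | +-suc i (toℕ t) = walk-adj (i + toℕ t)
      f-close : adj G (f (fromℕ (suc (suc m)))) (f zero) ≡ true
      f-close rewrite toℕ-fromℕ (suc (suc m)) | +-identityʳ i =
        subst (λ z → adj G (w (i + suc (suc m))) z ≡ true)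
              (trans (cong w (sym (+-suc i (suc (suc m))))) closed)
              (walk-adj (i + suc (suc m)))

    Repeats : ℕ → Set
    Repeats j = ∃[ i ] i < j × w i ≡ w j

    repeats? : ∀ j → Dec (Repeats j)
    repeats? j with any? (λ (k : Fin j) → w (toℕ k) ≟ w j)
    ... | yes (k , e) = yes (toℕ k , toℕ<n k , e)
    ... | no none     =
      no λ (i , i<j , e) → none (fromℕ< i<j , subst (λ z → w z ≡ w j) (sym (toℕ-fromℕ< i<j)) e)

    someRepeat : ∃[ j ] Repeats j
    someRepeat with pigeonhole (n<1+n N) (λ (t : Fin (suc N)) → w (toℕ t))
    ... | s , t , s<t , e = toℕ t , toℕ s , s<t , e

  -- The first repetition w i = w j closes the cycle w i, …, w (j - 1): its vertices are
  -- distinct by the minimality of j, and j - i ≥ 3 as there are no loops or backtracking.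
  nonBacktrackingWalk⇒cycle : Cycle G
  nonBacktrackingWalk⇒cycle with minimal repeats? (proj₂ someRepeat)
  ... | j , (i , i<j , e) , first with m≤n⇒∃[o]m+o≡n (<⇒≤ i<j)
  ... | k , refl = closedWalk⇒cycle i k i<j (sym e) (λ x<y y<j wx≡wy → first y<j (_ , x<y , wx≡wy))

module _ {N : ℕ} {G : Graph N} (wf : WellFormed G) (leafless : ∀ v → degree G v ≢ 1) where

  leafless-edge⇒cycle : ∀ {a b} → adj G a b ≡ true → Cycle G
  leafless-edge⇒cycle {a} {b} ab = nonBacktrackingWalk⇒cycle wf (proj₁ ∘ darts) walk-adj no-backtrack
    where
    darts : ℕ → Fin N × Fin N
    darts zero    = a , b
    darts (suc i) = let (x , y) = darts i in y , otherNeighbour G y x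

    walk-adj : ∀ i → adj G (proj₁ (darts i)) (proj₁ (darts (suc i))) ≡ true
    continues : ∀ i →
      (adj G (proj₁ (darts (suc i))) ∖ proj₁ (darts i)) (proj₁ (darts (suc (suc i)))) ≡ true

    walk-adj zero    = ab
    walk-adj (suc i) = proj₂ (∖-elim {p = adj G _} (continues i))
    continues i = otherNeighbour-adj G (trans (adj-sym wf _ _) (walk-adj i)) (leafless _)

    no-backtrack : ∀ i → proj₁ (darts (suc (suc i))) ≢ proj₁ (darts i)
    no-backtrack i = proj₁ (∖-elim {p = adj G _} (continues i))

isolate : ∀ {N} → Graph N → Fin N → Graph N
isolate G v = mkGraph (alive G) (λ a b → adj G a b ∧ not (does (a ≟ v)) ∧ not (does (b ≟ v)))

acyclic-⊆ : ∀ {N} {G H : Graph N} → (∀ a b → adj H a b ≡ true → adj G a b ≡ true) →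
            ¬ Cycle G → ¬ Cycle H
acyclic-⊆ H⊆G acyclic (m , f , f-injective , f-adj , f-close) =
  acyclic (m , f , f-injective , (λ t → H⊆G _ _ (f-adj t)) , H⊆G _ _ f-close)

module _ {N : ℕ} {G : Graph N} (wf : WellFormed G) (v : Fin N) where

  private
    isolate-⊆ : ∀ a b → adj (isolate G v) a b ≡ true → adj G a b ≡ true
    isolate-⊆ a b e = proj₁ (∧-true (adj G a b) e)

  isolate-wellFormed : WellFormed (isolate G v)
  adj-sym   isolate-wellFormed a b rewrite adj-sym wf a b =
    cong (adj G b a ∧_) (∧-comm (not (does (a ≟ v))) (not (does (b ≟ v))))
  adj-irr   isolate-wellFormed a rewrite adj-irr wf a = refl
  adj-alive isolate-wellFormed a b e = adj-alive wf a b (isolate-⊆ a b e)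

  isolate-acyclic : ¬ Cycle G → ¬ Cycle (isolate G v)
  isolate-acyclic = acyclic-⊆ {G = G} {H = isolate G v} isolate-⊆

  isolate-adj : ∀ {a b} → adj G a b ≡ true → a ≢ v → b ≢ v → adj (isolate G v) a b ≡ true
  isolate-adj {a} {b} ab a≢v b≢v rewrite ab | dec-false (a ≟ v) a≢v | dec-false (b ≟ v) b≢v = refl

  degreeSum-isolate : degree G v ≡ 1 → sum (degree (isolate G v)) < sum (degree G)
  degreeSum-isolate degree≡1 =
    sum-mono-< (λ a → count-mono _ (adj G a) (isolate-⊆ a)) v
               (subst₂ _<_ (sym (allFalse⇒count≡0 _ cut)) (sym degree≡1) (s≤s z≤n))
    where
    cut : ∀ b → adj (isolate G v) v b ≡ false
    cut b rewrite dec-true (v ≟ v) refl = ∧-zeroʳ (adj G v b)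

  attachLeaf : degree G v ≡ 1 → ParentMap (isolate G v) → ParentMap G
  attachLeaf degree≡1 P = record { parent = parent′ ; edge-parent = edge-parent′ }
    where
    neighbour : ∃[ u ] adj G v u ≡ true
    neighbour = count>0⇒∃ (adj G v) (subst (0 <_) (sym degree≡1) (s≤s z≤n))

    neighbour-unique : ∀ {y} → adj G v y ≡ true → proj₁ neighbour ≡ y
    neighbour-unique = count≤1⇒unique (adj G v) (≤-reflexive degree≡1) (proj₂ neighbour)

    parent′ : Fin N → Fin N
    parent′ x = if does (x ≟ v) then proj₁ neighbour else parent P x

    edge-parent′ : ∀ x y → adj G x y ≡ true → parent′ x ≡ y ⊎ parent′ y ≡ x
    edge-parent′ x y xy with x ≟ v | y ≟ v
    ... | yes refl | _        = inj₁ (neighbour-unique xy)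
    ... | no _     | yes refl = inj₂ (neighbour-unique (trans (adj-sym wf v x) xy))
    ... | no x≢v   | no y≢v   = edge-parent P x y (isolate-adj xy x≢v y≢v)

forest⇒parentMap : ∀ {N} {G : Graph N} → Forest G → ParentMap G
forest⇒parentMap {G = G} (wf , acyclic) = go (<-wellFounded (sum (degree G))) wf acyclic
  where
  go : ∀ {G} → Acc _<_ (sum (degree G)) → WellFormed G → ¬ Cycle G → ParentMap G
  go {G} (acc smaller) wf acyclic with any? (λ v → degree G v ≟ℕ 1)
  ... | yes (v , degree≡1) =
    attachLeaf wf v degree≡1 (go (smaller (degreeSum-isolate wf v degree≡1))
                                 (isolate-wellFormed wf v) (isolate-acyclic wf v acyclic))
  ... | no noLeaf = record
    { parent      = id
    ; edge-parent = λ _ _ ab → contradiction (leafless-edge⇒cycle wf leafless ab) acyclic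
    }
    where
    leafless : ∀ v → degree G v ≢ 1
    leafless v degree≡1 = noLeaf (v , degree≡1)

rounds-size : ∀ {N r} {G G′ : Graph N} → WellFormed G → ParentMap G → Rounds r G G′ →
              6 ^ r * size G′ ≤ 5 ^ r * size G
rounds-size wf P done = ≤-refl
rounds-size {r = suc r} {G} {G′} wf P (step S mcs rest) = begin
  6 ^ suc r * size G′               ≡⟨ *-assoc 6 (6 ^ r) (size G′) ⟩
  6 * (6 ^ r * size G′)             ≤⟨ *-monoʳ-≤ 6 rest-size ⟩
  6 * (5 ^ r * size (contract G S)) ≡⟨ swap 6 (5 ^ r) (size (contract G S)) ⟩
  5 ^ r * (6 * size (contract G S)) ≤⟨ *-monoʳ-≤ (5 ^ r) (6*size-contract≤5*size wf mcs P) ⟩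
  5 ^ r * (5 * size G)              ≡⟨ swap (5 ^ r) 5 (size G) ⟩
  5 * (5 ^ r * size G)              ≡⟨ *-assoc 5 (5 ^ r) (size G) ⟨
  5 ^ suc r * size G                ∎
  where
  open ≤-Reasoning
  rest-size : 6 ^ r * size G′ ≤ 5 ^ r * size (contract G S)
  rest-size = rounds-size (contract-wellFormed wf) (contract-parentMap wf P) rest
  swap : ∀ a b c → a * (b * c) ≡ b * (a * c)
  swap = solve-∀

size-complete : ∀ {N} (G : Graph N) → (∀ v → alive G v ≡ true) → size G ≡ N
size-complete {N} G complete =
  trans (count≡sum (alive G)) (trans (sum-cong-≗ (cong χ ∘ complete)) (sum-ones N))
  where
  sum-ones : ∀ N → sum {N} (λ _ → 1) ≡ N
  sum-ones zero    = refl
  sum-ones (suc N) = cong suc (sum-ones N)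

mainTheorem8 : (n : ℕ) (F : Graph n) → (∀ v → alive F v ≡ true) → Forest F →
               (k : ℕ) → 1 ≤ k → (r : ℕ) → IsCeilLog n k r →
               (F' : Graph n) → Rounds r F F' → size F' ≤ k
mainTheorem8 n F complete forest k _ r (5^r[k+n]≤6^rk , _) F' rounds =
  *-cancelˡ-≤ (6 ^ r) {{m^n≢0 6 r}} (begin
    6 ^ r * size F'  ≤⟨ rounds-size (proj₁ forest) (forest⇒parentMap forest) rounds ⟩
    5 ^ r * size F   ≡⟨ cong (5 ^ r *_) (size-complete F complete) ⟩
    5 ^ r * n        ≤⟨ *-monoʳ-≤ (5 ^ r) (m≤n+m n k) ⟩
    5 ^ r * (k + n)  ≤⟨ 5^r[k+n]≤6^rk ⟩
    6 ^ r * k        ∎)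
  where open ≤-Reasoning
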